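{- Let $G$ be a connected cograph which is not a complete graph, and let $F_1,\dots,F_k$ be its components. Then $$\kappa(G)=|G|-\max_{1\le i\le k}|F_i|.$$
   Context: A cograph is a graph obtainable from single-vertex graphs by repeatedly taking disjoint unions and joins (join: disjoint union plus all edges between vertices of different graphs). For a connected cograph $G$ with at least two vertices, its components $F_1,\dots,F_k$ are the subgraphs of $G$ induced on the vertex sets of the connected components of the complement graph $\bar G$; then $G$ is the join of $F_1,\dots,F_k$ and each $F_i$ is a one-vertex graph or a disconnected cograph. $|H|$ is the number of vertices of $H$. A connected graph is $k$-connected if no set of $k-1$ vertices disconnects it upon removal; the vertex connectivity $\kappa(G)$ is the largest $k$ such that $G$ is $k$-connected. -}

module Defs where

open import Data.Nat using (ℕ; zero; suc; _+_; _∸_; _≤_; _<_)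
open import Data.Bool using (Bool; true; false; not; _∧_)
open import Data.Fin using (Fin; splitAt; _≟_)
open import Data.Fin.Subset using (Subset; _∈_; _∉_; ∣_∣)
open import Data.Sum using (_⊎_; inj₁; inj₂)
open import Data.Product using (Σ; _×_; ∃; ∃-syntax; _,_)
open import Data.Unit using (⊤)
open import Relation.Nullary using (¬_; does)
open import Relation.Binary.PropositionalEquality using (_≡_; _≢_)
open import Function.Bundles using (_↔_; Inverse)

Graph : ℕ → Set
Graph n = Fin n → Fin n → Bool

IsSimple : ∀ {n} → Graph n → Set
IsSimple {n} G = (∀ (i j : Fin n) → G i j ≡ G j i) × (∀ (i : Fin n) → G i i ≡ false)

complement : ∀ {n} → Graph n → Graph n
complement G i j = not (G i j) ∧ not (does (i ≟ j))

IsComplete : ∀ {n} → Graph n → Set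
IsComplete {n} G = ∀ (i j : Fin n) → i ≢ j → G i j ≡ true

data Reach {n} (P : Fin n → Set) (G : Graph n) (u : Fin n) : Fin n → Set where
  here : P u → Reach P G u u
  step : ∀ {v w} → Reach P G u v → G v w ≡ true → P w → Reach P G u w

Everything : ∀ {n} → Fin n → Set
Everything _ = ⊤

IsConnected : ∀ {n} → Graph n → Set
IsConnected {n} G = ∀ (u v : Fin n) → Reach Everything G u v

_≅_ : ∀ {n m} → Graph n → Graph m → Set
_≅_ {n} {m} G H =
  Σ (Fin n ↔ Fin m) λ f → ∀ (i j : Fin n) → G i j ≡ H (Inverse.to f i) (Inverse.to f j)

data Cotree : ℕ → Set where
  leaf  : Cotree 1
  union : ∀ {m k} → Cotree m → Cotree k → Cotree (m + k)
  join  : ∀ {m k} → Cotree m → Cotree k → Cotree (m + k)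

-- adjacency of the disjoint union (cross = false) or join (cross = true)
combine : ∀ {m k} → Bool → Graph m → Graph k → Graph (m + k)
combine {m} cross G H i j with splitAt m i | splitAt m j
... | inj₁ a | inj₁ b = G a b
... | inj₂ a | inj₂ b = H a b
... | inj₁ _ | inj₂ _ = cross
... | inj₂ _ | inj₁ _ = cross

⟦_⟧ : ∀ {n} → Cotree n → Graph n
⟦ leaf ⟧ _ _ = false
⟦ union s t ⟧ = combine false ⟦ s ⟧ ⟦ t ⟧
⟦ join s t ⟧ = combine true ⟦ s ⟧ ⟦ t ⟧

IsCograph : ∀ {n} → Graph n → Set
IsCograph G = ∃[ k ] Σ (Cotree k) λ t → G ≅ ⟦ t ⟧

-- Components F_i of G: subgraphs induced on the connected components of the
-- complement.  The number of vertices of the component containing v is s: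

CompSize : ∀ {n} → Graph n → Fin n → ℕ → Set
CompSize {n} G v s =
  Σ (Subset n) λ S →
    (∀ (u : Fin n) → (u ∈ S → Reach Everything (complement G) v u)
                   × (Reach Everything (complement G) v u → u ∈ S))
    × ∣ S ∣ ≡ s

IsMaxCompSize : ∀ {n} → Graph n → ℕ → Set
IsMaxCompSize {n} G m =
  (Σ (Fin n) λ v → CompSize G v m)
  × (∀ (v : Fin n) (s : ℕ) → CompSize G v s → s ≤ m)

Disconnects : ∀ {n} → Graph n → Subset n → Set
Disconnects {n} G S =
  Σ (Fin n) λ u → Σ (Fin n) λ v →
    u ∉ S × v ∉ S × ¬ Reach (λ w → w ∉ S) G u v

IsKConnected : ∀ {n} → Graph n → ℕ → Set
IsKConnected {n} G k =
  IsConnected G × (∀ (S : Subset n) → ∣ S ∣ < k → ¬ Disconnects G S)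

IsConnectivity : ∀ {n} → Graph n → ℕ → Set
IsConnectivity G c = IsKConnected G c × (∀ k → IsKConnected G k → k ≤ c)

-- Vertices in different components F_i are adjacent.  Hence if S separates u from v,
-- every vertex outside S lies in the component of u (otherwise it would link u to v),
-- so |G| - |S| ≤ max |F_i|.  Conversely, deleting all vertices outside a largest
-- component F leaves G[F], which has two vertices since G is not complete.  Every
-- induced subgraph of a cograph on two or more vertices is disconnected or has
-- disconnected complement; the complement of G[F] is connected, so G[F] is disconnected.
module Submission where

open import Defs
open import Data.Nat using (ℕ; zero; suc; _+_; _∸_; _≤_; _<_; s≤s)
import Data.Nat.Properties as ℕ
open import Data.Bool using (Bool; true; false; not; _∧_)
open import Data.Bool.Properties using () renaming (_≟_ to _≟ᵇ_)
open import Data.Fin using (Fin; splitAt; _≟_; _↑ˡ_; _↑ʳ_)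
import Data.Fin.Properties as Finₚ
open import Data.Fin.Subset using (Subset; _∈_; _∉_; _⊆_; ∣_∣; ∁; _-_; ⁅_⁆)
import Data.Fin.Subset.Properties as Subset
open import Data.List using (allFin)
open import Data.List.Extrema.Nat using (argmax; f[xs]≤f[argmax])
open import Data.List.Membership.Propositional.Properties using (∈-allFin)
import Data.List.Relation.Unary.All as All
open import Data.Vec using (tabulate)
import Data.Vec.Properties as Vec
open import Data.Sum using (_⊎_; inj₁; inj₂; [_,_]′)
open import Data.Product using (Σ; _×_; ∃; ∃-syntax; _,_; proj₁; proj₂)
open import Data.Unit using (tt)
open import Function using (_∘_; const)
open import Function.Bundles using (Inverse)
open import Relation.Nullary using (¬_; Dec; yes; no; does; ¬?; contradiction)
open import Relation.Nullary.Decidable using (map′; _×-dec_; dec-true; dec-false; decidable-stable)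
open import Relation.Unary using (Decidable)
open import Relation.Binary.PropositionalEquality
  using (_≡_; _≢_; refl; sym; trans; cong; cong₂; subst)

module _ {n : ℕ} {K : Graph n} where

  reach-end : ∀ {P u v} → Reach P K u v → P v
  reach-end (here p) = p
  reach-end (step _ _ p) = p

  reach-mono : ∀ {P Q : Fin n → Set} {u v} → (∀ w → P w → Q w) → Reach P K u v → Reach Q K u v
  reach-mono f (here p) = here (f _ p)
  reach-mono f (step r e p) = step (reach-mono f r) e (f _ p)

  reach-trans : ∀ {P u v w} → Reach P K u v → Reach P K v w → Reach P K u w
  reach-trans r (here _) = r
  reach-trans r (step s e p) = step (reach-trans r s) e p

  reach-edge : ∀ {P : Fin n → Set} {u w} → P u → P w → K u w ≡ true → Reach P K u w
  reach-edge pu pw e = step (here pu) e pw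

  reach-sym : ∀ {P u v} → (∀ i j → K i j ≡ K j i) → Reach P K u v → Reach P K v u
  reach-sym s (here p) = here p
  reach-sym {v = w} s (step {v = x} r e p) =
    reach-trans (reach-edge p (reach-end r) (trans (s w x) e)) (reach-sym s r)

  reach-invariant : ∀ {A : Set} (f : Fin n → A) → (∀ v w → K v w ≡ true → f v ≡ f w) →
    ∀ {P u v} → Reach P K u v → f u ≡ f v
  reach-invariant f f-edge (here _) = refl
  reach-invariant f f-edge (step r e _) = trans (reach-invariant f f-edge r) (f-edge _ _ e)

  reach-split-at : ∀ {P : Fin n → Set} {u x} (t : Fin n) → Reach P K u x →
    Reach (λ y → P y × y ≢ t) K u x
    ⊎ (∃[ w ] Reach (λ y → P y × y ≢ t) K u w × K w t ≡ true)
    ⊎ u ≡ t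
  reach-split-at {u = u} t (here p) with u ≟ t
  ... | yes u≡t = inj₂ (inj₂ u≡t)
  ... | no u≢t = inj₁ (here (p , u≢t))
  reach-split-at t (step {v} {w} r e p) with reach-split-at t r
  ... | inj₂ z = inj₂ z
  ... | inj₁ r′ with w ≟ t
  ...   | yes refl = inj₂ (inj₁ (v , r′ , e))
  ...   | no w≢t = inj₁ (step r′ e (p , w≢t))

  -- Induction on the size of the allowed set p, which shrinks by the target at each step.
  reach-within? : ∀ (fuel : ℕ) (p : Subset n) → ∣ p ∣ < fuel → ∀ u v → Dec (Reach (_∈ p) K u v)
  reach-within? (suc fuel) p ∣p∣≤fuel u v with v Subset.∈? p
  ... | no v∉p = no (v∉p ∘ reach-end)
  ... | yes v∈p with u ≟ v
  ...   | yes refl = yes (here v∈p)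
  ...   | no u≢v with Finₚ.any? (λ w → reach-within? fuel (p - v) ∣p-v∣<fuel u w ×-dec (K w v ≟ᵇ true))
    where
    ∣p-v∣<fuel : ∣ p - v ∣ < fuel
    ∣p-v∣<fuel = ℕ.≤-trans (Subset.x∈p⇒∣p-x∣<∣p∣ v∈p) (ℕ.≤-pred ∣p∣≤fuel)
  ...     | yes (w , r , e) = yes (step (reach-mono (λ _ → Subset.p─q⊆p p ⁅ v ⁆) r) e v∈p)
  ...     | no ¬last = no last-step
    where
    last-step : ¬ Reach (_∈ p) K u v
    last-step r with reach-split-at v r
    ... | inj₁ r′ = proj₂ (reach-end r′) refl
    ... | inj₂ (inj₂ u≡v) = u≢v u≡v
    ... | inj₂ (inj₁ (w , r′ , e)) =
      ¬last (w , reach-mono (λ _ (y∈p , y≢v) → Subset.x∈p∧x≢y⇒x∈p-y y∈p y≢v) r′ , e)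

subsetOf : ∀ {n} {P : Fin n → Set} → Decidable P → Subset n
subsetOf P? = tabulate (does ∘ P?)

∈-subsetOf⁻ : ∀ {n} {P : Fin n → Set} (P? : Decidable P) {x} → x ∈ subsetOf P? → P x
∈-subsetOf⁻ P? {x} x∈ with P? x | trans (sym (Vec.lookup∘tabulate (does ∘ P?) x)) (Vec.[]=⇒lookup x∈)
... | yes px | _ = px

∈-subsetOf⁺ : ∀ {n} {P : Fin n → Set} (P? : Decidable P) {x} → P x → x ∈ subsetOf P?
∈-subsetOf⁺ P? {x} px = Vec.lookup⇒[]= x (subsetOf P?)
  (trans (Vec.lookup∘tabulate (does ∘ P?) x) (dec-true (P? x) px))

reach? : ∀ {n} (K : Graph n) {P : Fin n → Set} → Decidable P → ∀ u v → Dec (Reach P K u v)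
reach? {n} K P? u v = map′ (reach-mono (λ _ → ∈-subsetOf⁻ P?)) (reach-mono (λ _ → ∈-subsetOf⁺ P?))
  (reach-within? (suc n) (subsetOf P?) (s≤s (Subset.∣p∣≤n (subsetOf P?))) u v)

IsDisconnectedOn : ∀ {n} → Graph n → (Fin n → Set) → Set
IsDisconnectedOn {n} K X = ∃[ a ] ∃[ b ] X a × X b × ¬ Reach X K a b

SplitsOn : ∀ {n} → Graph n → (Fin n → Set) → Set
SplitsOn G X = IsDisconnectedOn G X ⊎ IsDisconnectedOn (complement G) X

-- Cographs are exactly the complement-reducible graphs (Corneil, Lerchs and Stewart);
-- only the easy direction, cographs are complement-reducible, is needed.
IsComplementReducible : ∀ {n} → Graph n → Set₁
IsComplementReducible {n} G =
  ∀ (X : Fin n → Set) → Decidable X → ∀ {a b} → X a → X b → a ≢ b → SplitsOn G X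

module _ {a N : ℕ} (e : Fin a → Fin N) (e-injective : ∀ {i j} → e i ≡ e j → i ≡ j) where

  does-≟-injective : ∀ i j → does (e i ≟ e j) ≡ does (i ≟ j)
  does-≟-injective i j with i ≟ j
  ... | yes refl = dec-true (e i ≟ e i) refl
  ... | no i≢j = dec-false (e i ≟ e j) (i≢j ∘ e-injective)

  complement-embedding : ∀ {K : Graph N} {K′ : Graph a} → (∀ i j → K (e i) (e j) ≡ K′ i j) →
    ∀ i j → complement K (e i) (e j) ≡ complement K′ i j
  complement-embedding K≡K′ i j
    rewrite K≡K′ i j | does-≟-injective i j = refl

  module _ {K : Graph N} {K′ : Graph a} (K≡K′ : ∀ i j → K (e i) (e j) ≡ K′ i j)
           {X : Fin N → Set} (X⊆image : ∀ x → X x → ∃[ i ] e i ≡ x) where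

    reach-preimage : ∀ {x y} → Reach X K x y → ∀ {i j} → e i ≡ x → e j ≡ y → Reach (X ∘ e) K′ i j
    reach-preimage (here p) ei≡x ej≡x with e-injective (trans ei≡x (sym ej≡x))
    ... | refl = here (subst X (sym ei≡x) p)
    reach-preimage (step {v} r edge p) ei≡x ej≡w with X⊆image v (reach-end r)
    ... | l , refl = step (reach-preimage r ei≡x refl)
                          (trans (sym (K≡K′ _ _)) (subst (λ w → K (e l) w ≡ true) (sym ej≡w) edge))
                          (subst X (sym ej≡w) p)

    isDisconnectedOn-image : IsDisconnectedOn K′ (X ∘ e) → IsDisconnectedOn K X
    isDisconnectedOn-image (i , j , xi , xj , ¬r) = e i , e j , xi , xj , λ r → ¬r (reach-preimage r refl refl)

  splitsOn-image : ∀ {G : Graph N} {G′ : Graph a} → (∀ i j → G (e i) (e j) ≡ G′ i j) →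
    IsComplementReducible G′ → (X : Fin N → Set) → Decidable X → (∀ x → X x → ∃[ i ] e i ≡ x) →
    ∀ {x y} → X x → X y → x ≢ y → SplitsOn G X
  splitsOn-image {G} G≡G′ reducible X X? X⊆image {x} {y} xx xy x≢y
    with X⊆image x xx | X⊆image y xy
  ... | i , refl | j , refl with reducible (X ∘ e) (X? ∘ e) xx xy (x≢y ∘ cong e)
  ...   | inj₁ split = inj₁ (isDisconnectedOn-image {K = G} G≡G′ X⊆image split)
  ...   | inj₂ split =
    inj₂ (isDisconnectedOn-image {K = complement G} (complement-embedding {K = G} G≡G′) X⊆image split)

module _ {m k : ℕ} where

  isLeft : Fin (m + k) → Bool
  isLeft x = [ const true , const false ]′ (splitAt m x)

  isLeft⇒↑ˡ : ∀ {x} → isLeft x ≡ true → ∃[ i ] i ↑ˡ k ≡ x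
  isLeft⇒↑ˡ {x} left with splitAt m x in eq
  ... | inj₁ i = i , Finₚ.splitAt⁻¹-↑ˡ eq

  ¬isLeft⇒↑ʳ : ∀ {x} → isLeft x ≡ false → ∃[ j ] m ↑ʳ j ≡ x
  ¬isLeft⇒↑ʳ {x} right with splitAt m x in eq
  ... | inj₂ j = j , Finₚ.splitAt⁻¹-↑ʳ eq

  combine-↑ˡ : ∀ c (G : Graph m) (H : Graph k) i j → combine c G H (i ↑ˡ k) (j ↑ˡ k) ≡ G i j
  combine-↑ˡ c G H i j rewrite Finₚ.splitAt-↑ˡ m i k | Finₚ.splitAt-↑ˡ m j k = refl

  combine-↑ʳ : ∀ c (G : Graph m) (H : Graph k) i j → combine c G H (m ↑ʳ i) (m ↑ʳ j) ≡ H i j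
  combine-↑ʳ c G H i j rewrite Finₚ.splitAt-↑ʳ m k i | Finₚ.splitAt-↑ʳ m k j = refl

  union-edge⇒same-side : ∀ (G : Graph m) (H : Graph k) v w →
    combine false G H v w ≡ true → isLeft v ≡ isLeft w
  union-edge⇒same-side G H v w e with splitAt m v | splitAt m w
  union-edge⇒same-side G H v w e  | inj₁ _ | inj₁ _ = refl
  union-edge⇒same-side G H v w e  | inj₂ _ | inj₂ _ = refl
  union-edge⇒same-side G H v w () | inj₁ _ | inj₂ _
  union-edge⇒same-side G H v w () | inj₂ _ | inj₁ _

  join-coedge⇒same-side : ∀ (G : Graph m) (H : Graph k) v w →
    complement (combine true G H) v w ≡ true → isLeft v ≡ isLeft w
  join-coedge⇒same-side G H v w e with splitAt m v | splitAt m w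
  join-coedge⇒same-side G H v w e  | inj₁ _ | inj₁ _ = refl
  join-coedge⇒same-side G H v w e  | inj₂ _ | inj₂ _ = refl
  join-coedge⇒same-side G H v w () | inj₁ _ | inj₂ _
  join-coedge⇒same-side G H v w () | inj₂ _ | inj₁ _

  splitsOn-combine-across : ∀ c (G : Graph m) (H : Graph k) (X : Fin (m + k) → Set) {x y} →
    X x → X y → isLeft x ≢ isLeft y → SplitsOn (combine c G H) X
  splitsOn-combine-across false G H X xx xy sides≢ =
    inj₁ (_ , _ , xx , xy , sides≢ ∘ reach-invariant isLeft (union-edge⇒same-side G H))
  splitsOn-combine-across true G H X xx xy sides≢ =
    inj₂ (_ , _ , xx , xy , sides≢ ∘ reach-invariant isLeft (join-coedge⇒same-side G H))

  splitsOn-combine-one-side : ∀ c {G : Graph m} {H : Graph k} →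
    IsComplementReducible G → IsComplementReducible H →
    (X : Fin (m + k) → Set) → Decidable X → ∀ {a b} → (∀ x → X x → isLeft x ≡ isLeft a) →
    X a → X b → a ≢ b → SplitsOn (combine c G H) X
  splitsOn-combine-one-side c {G} {H} reducibleG reducibleH X X? {a} same-side xa xb a≢b
    with isLeft a
  ... | true = splitsOn-image (_↑ˡ k) (Finₚ.↑ˡ-injective k _ _) (combine-↑ˡ c G H) reducibleG X X?
                 (λ x xx → isLeft⇒↑ˡ (same-side x xx)) xa xb a≢b
  ... | false = splitsOn-image (m ↑ʳ_) (Finₚ.↑ʳ-injective m _ _) (combine-↑ʳ c G H) reducibleH X X?
                 (λ x xx → ¬isLeft⇒↑ʳ (same-side x xx)) xa xb a≢b

  isComplementReducible-combine : ∀ c {G : Graph m} {H : Graph k} →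
    IsComplementReducible G → IsComplementReducible H → IsComplementReducible (combine c G H)
  isComplementReducible-combine c {G} {H} reducibleG reducibleH X X? {a} xa xb a≢b
    with Finₚ.any? (λ x → X? x ×-dec ¬? (isLeft x ≟ᵇ isLeft a))
  ... | yes (x , xx , sides≢) = splitsOn-combine-across c G H X xa xx (sides≢ ∘ sym)
  ... | no ¬across = splitsOn-combine-one-side c reducibleG reducibleH X X?
          (λ x xx → decidable-stable (isLeft x ≟ᵇ isLeft a) (λ sides≢ → ¬across (x , xx , sides≢)))
          xa xb a≢b

isComplementReducible-⟦⟧ : ∀ {n} (t : Cotree n) → IsComplementReducible ⟦ t ⟧
isComplementReducible-⟦⟧ leaf X X? {Fin.zero} {Fin.zero} _ _ a≢b = contradiction refl a≢b
isComplementReducible-⟦⟧ (union s t) =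
  isComplementReducible-combine false (isComplementReducible-⟦⟧ s) (isComplementReducible-⟦⟧ t)
isComplementReducible-⟦⟧ (join s t) =
  isComplementReducible-combine true (isComplementReducible-⟦⟧ s) (isComplementReducible-⟦⟧ t)

isComplementReducible-≅ : ∀ {n k} {G : Graph n} {T : Graph k} → G ≅ T →
  IsComplementReducible T → IsComplementReducible G
isComplementReducible-≅ {G = G} {T} (f , G≡T) reducibleT X X? =
  splitsOn-image from from-injective G≡T∘from reducibleT X X? (λ x _ → to x , strictlyInverseʳ x)
  where
  open Inverse f
  from-injective : ∀ {i j} → from i ≡ from j → i ≡ j
  from-injective {i} {j} eq = trans (sym (strictlyInverseˡ i)) (trans (cong to eq) (strictlyInverseˡ j))
  G≡T∘from : ∀ i j → G (from i) (from j) ≡ T i j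
  G≡T∘from i j = trans (G≡T (from i) (from j)) (cong₂ T (strictlyInverseˡ i) (strictlyInverseˡ j))

isComplementReducible : ∀ {n} {G : Graph n} → IsCograph G → IsComplementReducible G
isComplementReducible (_ , t , G≅⟦t⟧) = isComplementReducible-≅ G≅⟦t⟧ (isComplementReducible-⟦⟧ t)

m∸n≤o⇒m∸o≤n : ∀ m n o → m ∸ n ≤ o → m ∸ o ≤ n
m∸n≤o⇒m∸o≤n m n o m∸n≤o = ℕ.m≤n+o⇒m∸n≤o m o (begin
  m            ≤⟨ ℕ.m≤n+m∸n m n ⟩
  n + (m ∸ n)  ≤⟨ ℕ.+-monoʳ-≤ n m∸n≤o ⟩
  n + o        ≡⟨ ℕ.+-comm n o ⟩
  o + n        ∎)
  where open ℕ.≤-Reasoning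

module _ {n : ℕ} {p : Subset n} where

  x∈p∧y∈p∧x≢y⇒1<∣p∣ : ∀ {x y} → x ∈ p → y ∈ p → x ≢ y → 1 < ∣ p ∣
  x∈p∧y∈p∧x≢y⇒1<∣p∣ {x} {y} x∈p y∈p x≢y =
    subst (_< ∣ p ∣) (Subset.∣⁅x⁆∣≡1 x)
      (Subset.p⊂q⇒∣p∣<∣q∣ ((λ {z} z∈⁅x⁆ → subst (_∈ p) (sym (Subset.x∈⁅y⁆⇒x≡y x z∈⁅x⁆)) x∈p) ,
                           y , y∈p , Subset.x≢y⇒x∉⁅y⁆ (x≢y ∘ sym)))

  1<∣p∣⇒∃≢ : ∀ x → 1 < ∣ p ∣ → ∃[ y ] y ∈ p × y ≢ x
  1<∣p∣⇒∃≢ x 1<∣p∣ with Finₚ.any? (λ y → y Subset.∈? p ×-dec ¬? (y ≟ x))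
  ... | yes found = found
  ... | no ¬found = contradiction (subst (∣ p ∣ ≤_) (Subset.∣⁅x⁆∣≡1 x) (Subset.p⊆q⇒∣p∣≤∣q∣ p⊆⁅x⁆))
                                  (ℕ.<⇒≱ 1<∣p∣)
    where
    p⊆⁅x⁆ : p ⊆ ⁅ x ⁆
    p⊆⁅x⁆ {y} y∈p with y ≟ x
    ... | yes refl = Subset.x∈⁅x⁆ x
    ... | no y≢x = contradiction (y , y∈p , y≢x) ¬found

non-edge⇒coedge : ∀ {n} (G : Graph n) {x y} → x ≢ y → G x y ≡ false → complement G x y ≡ true
non-edge⇒coedge G {x} {y} x≢y Gxy rewrite Gxy | dec-false (x ≟ y) x≢y = refl

module _ {n : ℕ} {G : Graph n} {c : ℕ} (connected : IsConnected G) where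

  isConnectivity-byMinimumSeparator : (∀ S → Disconnects G S → c ≤ ∣ S ∣) →
    (S : Subset n) → Disconnects G S → ∣ S ∣ ≡ c → IsConnectivity G c
  isConnectivity-byMinimumSeparator c≤separator S separates ∣S∣≡c =
    (connected , λ T ∣T∣<c → ℕ.<⇒≱ ∣T∣<c ∘ c≤separator T) ,
    λ k (_ , no-small-separator) →
      ℕ.≮⇒≥ (λ c<k → no-small-separator S (subst (_< k) (sym ∣S∣≡c) c<k) separates)

module Components {n : ℕ} (G : Graph n) (G-sym : ∀ i j → G i j ≡ G j i) where

  SameComponent : Fin n → Fin n → Set
  SameComponent = Reach Everything (complement G)

  sameComponent? : ∀ u v → Dec (SameComponent u v)
  sameComponent? = reach? (complement G) (λ _ → yes tt)

  component : Fin n → Subset n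
  component v = subsetOf (sameComponent? v)

  ∈-component⁺ : ∀ {v x} → SameComponent v x → x ∈ component v
  ∈-component⁺ {v} = ∈-subsetOf⁺ (sameComponent? v)

  ∈-component⁻ : ∀ {v x} → x ∈ component v → SameComponent v x
  ∈-component⁻ {v} = ∈-subsetOf⁻ (sameComponent? v)

  v∈component[v] : ∀ v → v ∈ component v
  v∈component[v] v = ∈-component⁺ (here tt)

  complement-sym : ∀ i j → complement G i j ≡ complement G j i
  complement-sym i j = cong₂ (λ e d → not e ∧ not d) (G-sym i j) (does-≟-sym i j)
    where
    does-≟-sym : ∀ i j → does (i ≟ j) ≡ does (j ≟ i)
    does-≟-sym i j with i ≟ j
    ... | yes refl = sym (dec-true (i ≟ i) refl)
    ... | no i≢j = sym (dec-false (j ≟ i) (i≢j ∘ sym))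

  sameComponent-sym : ∀ {u v} → SameComponent u v → SameComponent v u
  sameComponent-sym = reach-sym complement-sym

  ¬sameComponent⇒adjacent : ∀ {x y} → ¬ SameComponent x y → G x y ≡ true
  ¬sameComponent⇒adjacent {x} {y} ¬same with G x y in Gxy
  ... | true = refl
  ... | false = contradiction (reach-edge tt tt (non-edge⇒coedge G x≢y Gxy)) ¬same
    where
    x≢y : x ≢ y
    x≢y refl = ¬same (here tt)

  reach-within-component : ∀ {v x} → SameComponent v x → Reach (SameComponent v) (complement G) v x
  reach-within-component (here t) = here (here t)
  reach-within-component (step r e t) = step (reach-within-component r) e (step r e t)

  ∈-component⇒reach-within : ∀ {v x} → x ∈ component v → Reach (_∈ component v) (complement G) v x
  ∈-component⇒reach-within = reach-mono (λ _ → ∈-component⁺) ∘ reach-within-component ∘ ∈-component⁻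

  compSize-component : ∀ v → CompSize G v ∣ component v ∣
  compSize-component v = component v , (λ _ → ∈-component⁻ , ∈-component⁺) , refl

  compSize⇒≤ : ∀ {v s} → CompSize G v s → s ≤ ∣ component v ∣
  compSize⇒≤ {v} (S , S≡component , refl) =
    Subset.p⊆q⇒∣p∣≤∣q∣ (λ {x} x∈S → ∈-component⁺ (proj₁ (S≡component x) x∈S))

  components-≤1⇒complete : (∀ v → ∣ component v ∣ ≤ 1) → IsComplete G
  components-≤1⇒complete small i j i≢j with G i j in Gij
  ... | true = refl
  ... | false = contradiction (small i) (ℕ.<⇒≱ (x∈p∧y∈p∧x≢y⇒1<∣p∣ (v∈component[v] i) j∈ i≢j))
    where
    j∈ : j ∈ component i
    j∈ = ∈-component⁺ (reach-edge tt tt (non-edge⇒coedge G i≢j Gij))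

  ∁separator⊆component : ∀ {S} → Disconnects G S → ∃[ u ] ∁ S ⊆ component u
  ∁separator⊆component {S} (u , v , u∉S , v∉S , ¬path) = u , λ {x} x∈∁S →
    ∈-component⁺ (decidable-stable (sameComponent? u x) (¬path ∘ detour (Subset.x∈∁p⇒x∉p x∈∁S)))
    where
    detour : ∀ {x} → x ∉ S → ¬ SameComponent u x → Reach (_∉ S) G u v
    detour {x} x∉S ¬ux with sameComponent? u v
    ... | no ¬uv = reach-edge u∉S v∉S (¬sameComponent⇒adjacent ¬uv)
    ... | yes uv = step (reach-edge u∉S x∉S (¬sameComponent⇒adjacent ¬ux))
                        (¬sameComponent⇒adjacent (¬ux ∘ reach-trans uv ∘ sameComponent-sym)) v∉S

  separator-≥ : ∀ {m} → (∀ v → ∣ component v ∣ ≤ m) → ∀ S → Disconnects G S → n ∸ m ≤ ∣ S ∣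
  separator-≥ {m} ≤m S separates with ∁separator⊆component separates
  ... | u , ∁S⊆component = m∸n≤o⇒m∸o≤n n ∣ S ∣ m (begin
    n ∸ ∣ S ∣          ≡⟨ Subset.∣∁p∣≡n∸∣p∣ S ⟨
    ∣ ∁ S ∣            ≤⟨ Subset.p⊆q⇒∣p∣≤∣q∣ ∁S⊆component ⟩
    ∣ component u ∣    ≤⟨ ≤m u ⟩
    m                  ∎)
    where open ℕ.≤-Reasoning

  ∁component-disconnects : IsComplementReducible G → ∀ {v} → 1 < ∣ component v ∣ →
    Disconnects G (∁ (component v))
  ∁component-disconnects reducible {v} 1<∣F∣ with 1<∣p∣⇒∃≢ v 1<∣F∣
  ... | w , w∈F , w≢v
    with reducible (_∈ component v) (Subset._∈? component v) w∈F (v∈component[v] v) w≢v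
  ... | inj₁ (a , b , a∈F , b∈F , ¬path) =
    a , b , Subset.x∈p⇒x∉∁p a∈F , Subset.x∈p⇒x∉∁p b∈F , ¬path ∘ reach-mono (λ _ → Subset.x∉∁p⇒x∈p)
  ... | inj₂ (a , b , a∈F , b∈F , ¬copath) = contradiction
    (reach-trans (reach-sym complement-sym (∈-component⇒reach-within a∈F)) (∈-component⇒reach-within b∈F))
    ¬copath

lemma7p1 : ∀ (n : ℕ) (G : Graph n) → IsSimple G → IsCograph G → IsConnected G →
    ¬ IsComplete G →
    Σ ℕ (λ m → IsMaxCompSize G m × IsConnectivity G (n ∸ m))
lemma7p1 zero G _ _ _ ¬complete = contradiction (λ ()) ¬complete
lemma7p1 (suc n) G (G-sym , _) cograph connected ¬complete =
  m , ((v* , compSize-component v*) , λ v s size → ℕ.≤-trans (compSize⇒≤ size) (≤m v)) ,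
  isConnectivity-byMinimumSeparator connected (separator-≥ ≤m)
    (∁ (component v*)) (∁component-disconnects (isComplementReducible cograph) 1<m)
    (Subset.∣∁p∣≡n∸∣p∣ (component v*))
  where
  open Components G G-sym
  size : Fin (suc n) → ℕ
  size v = ∣ component v ∣
  v* : Fin (suc n)
  v* = argmax size Fin.zero (allFin (suc n))
  m : ℕ
  m = size v*
  ≤m : ∀ v → size v ≤ m
  ≤m v = All.lookup (f[xs]≤f[argmax] {f = size} Fin.zero (allFin (suc n))) (∈-allFin v)
  1<m : 1 < m
  1<m = ℕ.≰⇒> (¬complete ∘ components-≤1⇒complete ∘ λ m≤1 v → ℕ.≤-trans (≤m v) m≤1)
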